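{- Let $\mathcal{R}$ be a strict polarized rectifier network with $m$ edges realizing a diagram $G$, and let $y$ be an auxiliary vertex of $\mathcal{R}$. If the in-degree or the out-degree of $y$ is $1$, then there is a strict polarized rectifier network realizing $G$ with at most $m-1$ edges.
   Context: A diagram is a loopless graph with undirected and directed edges such that for all $u,v$ at most one of $\{u,v\},(u,v),(v,u)$ is an edge. A polarized diagram of a diagram is a pair $(G',p)$ where $G'$ is obtained by orienting each undirected edge arbitrarily and $p:E(G')\to\{ -,+\}$ assigns $-$ to formerly undirected edges and $+$ to originally directed edges. A polarized rectifier network (PRN) is $\mathcal{R}=(B,A,E,p)$ with $B,A$ disjoint vertex sets (base and auxiliary), $(B\sqcup A,E)$ a loopless directed graph (its edges are the edges of $\mathcal{R}$; in- and out-degrees refer to this graph), and $p:\{(u,v)\in E:v\in B\}\to\{ -,+\}$. For $u,v\in B$ (possibly equal), a valid walk from $u$ to $v$ is a sequence $(\pi_1,\dots,\pi_k)$, $k\ge2$, with $\pi_1=u$, $\pi_k=v$, each $(\pi_i,\pi_{i+1})\in E$, and $\pi_i\in A$ for $2\le i\le k-1$; its polarity is $p(\pi_{k-1},\pi_k)$. A PRN $(V(G'),A,E,p')$ realizes a polarized diagram $(G',p)$ if for all $u,v\in V(G')$ (possibly equal), $(u,v)\in E(G')$ iff there is a valid walk from $u$ to $v$ with polarity $p(u,v)$ (and there is no valid walk when $(u,v)\notin E(G')$); it realizes a diagram $G$ if it realizes some polarized diagram of $G$. A PRN is strict if (1) for every 2-element $\{u,v\}\subseteq B$ there is at most one valid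 walk from $u$ to $v$ or from $v$ to $u$ in total, and (2) every vertex of $A$ lies on some valid walk. -}

module Defs where

open import Data.Nat using (ℕ)
open import Data.Bool using (Bool; T)
open import Data.Fin using (Fin)
import Data.Fin.Properties as FinP
open import Data.Sum using (_⊎_; inj₁; inj₂)
import Data.Sum.Properties as SumP
open import Data.Product using (Σ; ∃; ∃-syntax; _×_; _,_; proj₁; proj₂)
open import Data.List using (List; []; _∷_; length; filter; allFin)
open import Data.List.Membership.Propositional using (_∈_)
open import Data.Empty using (⊥)
open import Relation.Nullary using (¬_)
open import Relation.Binary.PropositionalEquality using (_≡_; _≢_)
open import Function.Definitions using (Injective)

-- Diagrams on the vertex set Fin n.
-- und u v : {u,v} is an undirected edge (stored symmetrically)
-- dir u v : (u,v) is a directed edge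

record Diagram (n : ℕ) : Set where
  field
    und : Fin n → Fin n → Bool
    dir : Fin n → Fin n → Bool
    und-sym      : ∀ u v → T (und u v) → T (und v u)
    und-loopless : ∀ u → ¬ T (und u u)
    dir-loopless : ∀ u → ¬ T (dir u u)
    excl-und-dir : ∀ u v → T (und u v) → ¬ T (dir u v)
    excl-dir-dir : ∀ u v → T (dir u v) → ¬ T (dir v u)

-- An orientation of the undirected edges of G: O u v means the undirected
-- edge {u,v} is oriented as (u,v).  The polarized diagram (G', p) determined
-- by O has E(G') = {(u,v) | dir u v or O u v}, with p(u,v) = + if dir u v
-- and p(u,v) = - if O u v.
record Orientation {n : ℕ} (G : Diagram n) : Set where
  open Diagram G
  field
    O : Fin n → Fin n → Bool
    O-und : ∀ u v → T (O u v) → T (und u v)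
    O-total : ∀ u v → T (und u v) → T (O u v) ⊎ T (O v u)
    O-antisym : ∀ u v → T (O u v) → ¬ T (O v u)

data Pol : Set where
  neg pos : Pol

-- Polarized rectifier networks with base vertex set B = Fin n and
-- auxiliary vertex set A = Fin k.  Vertices are Fin n ⊎ Fin k
-- (inj₁ = base, inj₂ = auxiliary).  The edge set E is given as an
-- injective enumeration edge : Fin m → V × V, so m = |E|.
-- The polarity is given as a total function on Fin m; only its values on
-- edges whose head lies in B are ever used.

record PRN (n : ℕ) : Set where
  field
    k : ℕ
    m : ℕ
    edge : Fin m → (Fin n ⊎ Fin k) × (Fin n ⊎ Fin k)
    edge-inj : Injective _≡_ _≡_ edge
    loopless : ∀ e → proj₁ (edge e) ≢ proj₂ (edge e)
    pol : Fin m → Pol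

module _ {n : ℕ} (R : PRN n) where
  open PRN R

  V : Set
  V = Fin n ⊎ Fin k

  Edge : V → V → Set
  Edge x y = ∃[ e ] edge e ≡ (x , y)

  _≟V_ : (x y : V) → _
  _≟V_ = SumP.≡-dec FinP._≟_ FinP._≟_

  InDeg : V → ℕ
  InDeg x = length (filter (λ e → proj₂ (edge e) ≟V x) (allFin m))

  OutDeg : V → ℕ
  OutDeg x = length (filter (λ e → proj₁ (edge e) ≟V x) (allFin m))

  data Tail : V → List (Fin k) → Fin n → Pol → Set where
    last : ∀ {x v} (e : Fin m) → edge e ≡ (x , inj₁ v) → Tail x [] v (pol e)
    step : ∀ {x a as v s} → Edge x (inj₂ a) → Tail (inj₂ a) as v s →
           Tail x (a ∷ as) v s

  -- A valid walk from u to v with polarity s, whose interior (auxiliary)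
  -- vertices are as.  A valid walk is identified with its vertex sequence,
  -- i.e. with the list as of interior vertices.
  ValidWalk : Fin n → List (Fin k) → Fin n → Pol → Set
  ValidWalk u as v s = Tail (inj₁ u) as v s

  Strict : Set
  Strict =
    (∀ u v → u ≢ v →
       (∀ as bs s t → ValidWalk u as v s → ValidWalk u bs v t → as ≡ bs)
     × (∀ as bs s t → ValidWalk u as v s → ValidWalk v bs u t → ⊥))
    × (∀ (a : Fin k) → ∃[ u ] ∃[ v ] ∃[ as ] ∃[ s ] (ValidWalk u as v s × a ∈ as))

  RealizesPolarized : (G : Diagram n) → Orientation G → Set
  RealizesPolarized G O' =
    ∀ u v →
      (T (dir u v) → ∃[ as ] ValidWalk u as v pos)
    × (T (O u v) → ∃[ as ] ValidWalk u as v neg)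
    × (¬ T (dir u v) → ¬ T (O u v) → ∀ as s → ¬ ValidWalk u as v s)
    where
      open Diagram G
      open Orientation O'

  Realizes : Diagram n → Set
  Realizes G = Σ (Orientation G) (RealizesPolarized G)

-- Contract the edge e joining y to its other end c, identifying y with c.
-- A walk of the old network maps to a walk of the new one by deleting y from
-- its interior, and every walk of the new network lifts back by reinserting e;
-- so the two networks have the same valid walks up to this deletion and realize
-- the same polarized diagram, and strictness transfers.  Contraction could only
-- create a parallel edge or a loop from an edge x → z next to a path x → y → z,
-- or from a 2-cycle through y.  Strictness excludes both: they yield either a
-- closed valid walk or two tails from one vertex to the same end whose interiors
-- have different lengths, whereas prefixing a common walk into that vertex would
-- make the interiors equal.
module Submission where

open import Defs
open import Data.Nat using (ℕ; zero; suc; _≤_; _∸_)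
open import Data.Nat.Properties using (≤-refl)
open import Data.Fin using (Fin; punchIn; punchOut)
open import Data.Fin.Properties
  using (_≟_; punchInᵢ≢i; punchIn-injective; punchIn-punchOut; punchOut-punchIn; punchOut-cong;
         punchOut-injective)
open import Data.Sum using (_⊎_; inj₁; inj₂)
open import Data.Sum.Properties using (inj₂-injective)
open import Data.Product using (∃-syntax; ∃!; _×_; _,_; proj₁; proj₂; map; map₂)
open import Data.List using (List; []; _∷_; _++_; length; filter; allFin)
open import Data.List.Properties using (++-cancelˡ; ++-identityˡ-unique)
open import Data.List.Membership.Propositional using (_∈_)
open import Data.List.Membership.Propositional.Properties using (∈-filter⁺; ∈-filter⁻; ∈-allFin)
open import Data.List.Relation.Unary.Any using (here; there)
open import Data.Empty using (⊥-elim)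
open import Function using (_∘_)
open import Function.Definitions using (Injective)
open import Relation.Nullary using (¬_; yes; no)
open import Relation.Unary using (Decidable)
open import Relation.Binary.Definitions using (DecidableEquality)
open import Relation.Binary.PropositionalEquality using (_≡_; _≢_; refl; sym; trans; cong; subst; subst₂)

length-filter-allFin≡1⇒∃! : ∀ {m} {P : Fin m → Set} (P? : Decidable P) →
  length (filter P? (allFin m)) ≡ 1 → ∃! _≡_ P
length-filter-allFin≡1⇒∃! {m} P? _ with filter P? (allFin m) in eq
... | f ∷ [] = f , proj₂ (∈-filter⁻ P? {xs = allFin m} (subst (f ∈_) (sym eq) (here refl))) ,
               λ {g} Pg → sole (subst (g ∈_) eq (∈-filter⁺ P? (∈-allFin g) Pg))
  where
  sole : ∀ {g} → g ∈ f ∷ [] → f ≡ g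
  sole (here g≡f) = sym g≡f

module StrictNetwork {n} {R : PRN n} {G : Diagram n} {O : Orientation G}
                     (realizes : RealizesPolarized R G O) (strict : Strict R) where
  open Diagram G using (dir-loopless; und-loopless)
  open Orientation O using (O-und)

  no-closed-walk : ∀ {u as s} → ¬ ValidWalk R u as u s
  no-closed-walk {u} = proj₂ (proj₂ (realizes u u)) (dir-loopless u) (und-loopless u ∘ O-und u u) _ _

  validWalk-unique : ∀ {u v as bs s t} → ValidWalk R u as v s → ValidWalk R u bs v t → as ≡ bs
  validWalk-unique {u} {v} W₁ W₂ with u ≟ v
  ... | yes refl = ⊥-elim (no-closed-walk W₁)
  ... | no u≢v = proj₁ (proj₁ strict u v u≢v) _ _ _ _ W₁ W₂

  Reachable : V R → Set
  Reachable x = ∃[ u ] ∃[ ps ] (∀ {bs v s} → Tail R x bs v s → ValidWalk R u (ps ++ bs) v s)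

  split : ∀ {x as v s a} → Tail R x as v s → a ∈ as →
          (∃[ qs ] Tail R (inj₂ a) qs v s) ×
          ∃[ ps ] (∀ {bs v′ s′} → Tail R (inj₂ a) bs v′ s′ → Tail R x (ps ++ bs) v′ s′)
  split (step E T) (here refl) = (_ , T) , _ ∷ [] , step E
  split (step E T) (there a∈as) with split T a∈as
  ... | rest , ps , extend = rest , _ ∷ ps , λ T′ → step E (extend T′)

  on-walk : ∀ a → Reachable (inj₂ a) × ∃[ qs ] ∃[ v ] ∃[ s ] Tail R (inj₂ a) qs v s
  on-walk a with proj₂ strict a
  ... | u , v , _ , s , W , a∈as with split W a∈as
  ...   | (qs , T) , ps , extend = (u , ps , extend) , qs , v , s , T

  reachable : ∀ x → Reachable x
  reachable (inj₁ u) = u , [] , λ W → W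
  reachable (inj₂ a) = proj₁ (on-walk a)

  tail-unique : ∀ {x as bs v s t} → Tail R x as v s → Tail R x bs v t → as ≡ bs
  tail-unique {x} T₁ T₂ with reachable x
  ... | _ , ps , extend = ++-cancelˡ ps _ _ (validWalk-unique (extend T₁) (extend T₂))

  continuation : ∀ z → ∃[ v ] ∃[ qs ] (∀ {x} → Edge R x z → ∃[ s ] Tail R x qs v s)
  continuation (inj₁ v) = v , [] , λ { (f , eq) → PRN.pol R f , last f eq }
  continuation (inj₂ a) with proj₂ (on-walk a)
  ... | qs , v , s , T = v , a ∷ qs , λ E → s , step E T

  no-shortcut : ∀ {x b z} → Edge R x (inj₂ b) → Edge R (inj₂ b) z → ¬ Edge R x z
  no-shortcut {z = z} E₁ E₂ E₃ with continuation z
  ... | _ , _ , continue with tail-unique (proj₂ (continue E₃)) (step E₁ (proj₂ (continue E₂)))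
  ...   | qs≡b∷qs with ++-identityˡ-unique (_ ∷ []) qs≡b∷qs
  ...     | ()

  no-2-cycle : ∀ {x b} → Edge R x (inj₂ b) → ¬ Edge R (inj₂ b) x
  no-2-cycle {inj₁ _} E₁ (f , eq) = no-closed-walk (step E₁ (last f eq))
  no-2-cycle {inj₂ a} E₁ E₂ with proj₂ (on-walk a)
  ... | _ , _ , _ , T with ++-identityˡ-unique (_ ∷ _ ∷ []) (tail-unique T (step E₁ (step E₂ T)))
  ...   | ()

data Pendant {n} (R : PRN n) (y : Fin (PRN.k R)) (e : Fin (PRN.m R)) (c : V R) : Set where
  sole-in  : PRN.edge R e ≡ (c , inj₂ y) →
             (∀ {f} → proj₂ (PRN.edge R f) ≡ inj₂ y → e ≡ f) → Pendant R y e c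
  sole-out : PRN.edge R e ≡ (inj₂ y , c) →
             (∀ {f} → proj₁ (PRN.edge R f) ≡ inj₂ y → e ≡ f) → Pendant R y e c

module _ {n} {R : PRN n} {y : Fin (PRN.k R)} {e : Fin (PRN.m R)} {c : V R} where
  open PRN R

  e-joins : Pendant R y e c → edge e ≡ (c , inj₂ y) ⊎ edge e ≡ (inj₂ y , c)
  e-joins (sole-in e≡ _) = inj₁ e≡
  e-joins (sole-out e≡ _) = inj₂ e≡

  out-of-y⇒e-into-y : Pendant R y e c → ∀ {f} → f ≢ e → proj₁ (edge f) ≡ inj₂ y →
                      edge e ≡ (c , inj₂ y)
  out-of-y⇒e-into-y (sole-in e≡ _) _ _ = e≡
  out-of-y⇒e-into-y (sole-out _ only-e) f≢e src≡y = ⊥-elim (f≢e (sym (only-e src≡y)))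

  into-y⇒e-out-of-y : Pendant R y e c → ∀ {f} → f ≢ e → proj₂ (edge f) ≡ inj₂ y →
                      edge e ≡ (inj₂ y , c)
  into-y⇒e-out-of-y (sole-in _ only-e) f≢e dst≡y = ⊥-elim (f≢e (sym (only-e dst≡y)))
  into-y⇒e-out-of-y (sole-out e≡ _) _ _ = e≡

  only-e-out-of-y : Pendant R y e c → ∀ {f} → edge e ≡ (inj₂ y , c) → proj₁ (edge f) ≡ inj₂ y →
                    f ≡ e
  only-e-out-of-y (sole-in e≡′ _) e≡ _ =
    ⊥-elim (loopless e (trans (cong proj₁ e≡) (sym (cong proj₂ e≡′))))
  only-e-out-of-y (sole-out _ only-e) _ src≡y = sym (only-e src≡y)

pendant-of-degree : ∀ {n} (R : PRN n) (y : Fin (PRN.k R)) →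
  InDeg R (inj₂ y) ≡ 1 ⊎ OutDeg R (inj₂ y) ≡ 1 → ∃[ e ] ∃[ c ] Pendant R y e c
pendant-of-degree R y (inj₁ in≡1)
  with length-filter-allFin≡1⇒∃! (λ f → _≟V_ R (proj₂ (PRN.edge R f)) (inj₂ y)) in≡1
... | e , dst≡y , only-e = e , _ , sole-in (cong (proj₁ (PRN.edge R e) ,_) dst≡y) only-e
pendant-of-degree R y (inj₂ out≡1)
  with length-filter-allFin≡1⇒∃! (λ f → _≟V_ R (proj₁ (PRN.edge R f)) (inj₂ y)) out≡1
... | e , src≡y , only-e = e , _ , sole-out (cong (_, proj₂ (PRN.edge R e)) src≡y) only-e

module Network {n k m : ℕ}
  (edge : Fin (suc m) → (Fin n ⊎ Fin (suc k)) × (Fin n ⊎ Fin (suc k)))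
  (edge-inj : Injective _≡_ _≡_ edge)
  (loopless : ∀ f → proj₁ (edge f) ≢ proj₂ (edge f))
  (pol : Fin (suc m) → Pol)
  where

  R : PRN n
  R = record { k = suc k ; m = suc m ; edge = edge ; edge-inj = edge-inj ; loopless = loopless ; pol = pol }

  src dst : Fin (suc m) → V R
  src f = proj₁ (edge f)
  dst f = proj₂ (edge f)

  _≟ᵛ_ : DecidableEquality (V R)
  _≟ᵛ_ = _≟V_ R

  distinct-ends : ∀ {f x z} → edge f ≡ (x , z) → x ≢ z
  distinct-ends {f} eq = subst (λ p → proj₁ p ≢ proj₂ p) eq (loopless f)

  module Contraction {G : Diagram n} {O : Orientation G}
                     (realizes : RealizesPolarized R G O) (strict : Strict R)
                     {y : Fin (suc k)} {e : Fin (suc m)} {c : V R} (pendant : Pendant R y e c) where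
    open StrictNetwork {R = R} {G = G} {O = O} realizes strict

    c≢y : c ≢ inj₂ y
    c≢y with e-joins pendant
    ... | inj₁ e≡ = distinct-ends e≡
    ... | inj₂ e≡ = distinct-ends e≡ ∘ sym

    e-into-y : ∀ {x} → edge e ≡ (x , inj₂ y) → x ≡ c
    e-into-y eq with e-joins pendant
    ... | inj₁ e≡ = cong proj₁ (trans (sym eq) e≡)
    ... | inj₂ e≡ = ⊥-elim (c≢y (cong proj₂ (trans (sym e≡) eq)))

    V′ : Set
    V′ = Fin n ⊎ Fin k

    squeeze : (x : V R) → x ≢ inj₂ y → V′
    squeeze (inj₁ v) _ = inj₁ v
    squeeze (inj₂ a) a≢y = inj₂ (punchOut (a≢y ∘ cong inj₂ ∘ sym))

    merge : V R → V′
    merge (inj₁ v) = inj₁ v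
    merge (inj₂ a) with y ≟ a
    ... | yes _ = squeeze c c≢y
    ... | no y≢a = inj₂ (punchOut y≢a)

    merge-ends : V R × V R → V′ × V′
    merge-ends (x , z) = merge x , merge z

    merge-≢y : ∀ {x} (x≢y : x ≢ inj₂ y) → merge x ≡ squeeze x x≢y
    merge-≢y {inj₁ _} _ = refl
    merge-≢y {inj₂ a} a≢y with y ≟ a
    ... | yes y≡a = ⊥-elim (a≢y (cong inj₂ (sym y≡a)))
    ... | no _ = cong inj₂ (punchOut-cong y refl)

    merge-y : merge (inj₂ y) ≡ merge c
    merge-y with y ≟ y
    ... | yes _ = sym (merge-≢y c≢y)
    ... | no y≢y = ⊥-elim (y≢y refl)

    squeeze-injective : ∀ {x z} (x≢y : x ≢ inj₂ y) (z≢y : z ≢ inj₂ y) →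
                        squeeze x x≢y ≡ squeeze z z≢y → x ≡ z
    squeeze-injective {inj₁ _} {inj₁ _} _ _ refl = refl
    squeeze-injective {inj₂ _} {inj₂ _} a≢y b≢y eq =
      cong inj₂ (punchOut-injective (a≢y ∘ cong inj₂ ∘ sym) (b≢y ∘ cong inj₂ ∘ sym)
                                    (inj₂-injective eq))

    merge-injective-off-y : ∀ {x z} → x ≢ inj₂ y → z ≢ inj₂ y → merge x ≡ merge z → x ≡ z
    merge-injective-off-y x≢y z≢y eq =
      squeeze-injective x≢y z≢y (trans (sym (merge-≢y x≢y)) (trans eq (merge-≢y z≢y)))

    data _~_ : V R → V R → Set where
      same : ∀ {x} → x ~ x
      y~c : inj₂ y ~ c
      c~y : c ~ inj₂ y

    merge-kernel : ∀ {x z} → merge x ≡ merge z → x ~ z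
    merge-kernel {x} {z} eq with x ≟ᵛ inj₂ y | z ≟ᵛ inj₂ y
    ... | yes refl | yes refl = same
    ... | yes refl | no z≢y =
      subst (inj₂ y ~_) (merge-injective-off-y c≢y z≢y (trans (sym merge-y) eq)) y~c
    ... | no x≢y | yes refl =
      subst (_~ inj₂ y) (merge-injective-off-y c≢y x≢y (trans (sym merge-y) (sym eq))) c~y
    ... | no x≢y | no z≢y = subst (x ~_) (merge-injective-off-y x≢y z≢y eq) same

    ~-loopless : ∀ {f x z} → f ≢ e → edge f ≡ (x , z) → ¬ x ~ z
    ~-loopless _ eq same = distinct-ends eq refl
    ~-loopless f≢e eq y~c = no-2-cycle (e , out-of-y⇒e-into-y pendant f≢e (cong proj₁ eq)) (_ , eq)
    ~-loopless f≢e eq c~y = no-2-cycle (_ , eq) (e , into-y⇒e-out-of-y pendant f≢e (cong proj₂ eq))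

    ~-edge-injective : ∀ {f g x₁ z₁ x₂ z₂} → f ≢ e → g ≢ e →
                       edge f ≡ (x₁ , z₁) → edge g ≡ (x₂ , z₂) →
                       x₁ ~ x₂ → z₁ ~ z₂ → f ≡ g
    ~-edge-injective _ _ eqf eqg same same = edge-inj (trans eqf (sym eqg))
    ~-edge-injective f≢e _ eqf eqg same y~c =
      ⊥-elim (no-shortcut (_ , eqf) (e , into-y⇒e-out-of-y pendant f≢e (cong proj₂ eqf)) (_ , eqg))
    ~-edge-injective _ g≢e eqf eqg same c~y =
      ⊥-elim (no-shortcut (_ , eqg) (e , into-y⇒e-out-of-y pendant g≢e (cong proj₂ eqg)) (_ , eqf))
    ~-edge-injective f≢e _ eqf eqg y~c same =
      ⊥-elim (no-shortcut (e , out-of-y⇒e-into-y pendant f≢e (cong proj₁ eqf)) (_ , eqf) (_ , eqg))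
    ~-edge-injective _ g≢e eqf eqg c~y same =
      ⊥-elim (no-shortcut (e , out-of-y⇒e-into-y pendant g≢e (cong proj₁ eqg)) (_ , eqg) (_ , eqf))
    ~-edge-injective f≢e _ eqf _ y~c y~c = ⊥-elim (~-loopless f≢e eqf same)
    ~-edge-injective f≢e _ eqf _ y~c c~y = ⊥-elim (~-loopless f≢e eqf y~c)
    ~-edge-injective f≢e _ eqf _ c~y y~c = ⊥-elim (~-loopless f≢e eqf c~y)
    ~-edge-injective f≢e _ eqf _ c~y c~y = ⊥-elim (~-loopless f≢e eqf same)

    -- An edge into y stands for itself followed by e, so it carries the polarity of e.
    lastPol : Fin (suc m) → Pol
    lastPol f with dst f ≟ᵛ inj₂ y
    ... | yes _ = pol e
    ... | no _ = pol f

    lastPol-y : ∀ {f x} → edge f ≡ (x , inj₂ y) → lastPol f ≡ pol e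
    lastPol-y {f} eq with dst f ≟ᵛ inj₂ y
    ... | yes _ = refl
    ... | no dst≢y = ⊥-elim (dst≢y (cong proj₂ eq))

    lastPol-≢y : ∀ {f x z} → edge f ≡ (x , z) → z ≢ inj₂ y → lastPol f ≡ pol f
    lastPol-≢y {f} eq z≢y with dst f ≟ᵛ inj₂ y
    ... | yes dst≡y = ⊥-elim (z≢y (trans (sym (cong proj₂ eq)) dst≡y))
    ... | no _ = refl

    R′ : PRN n
    R′ = record
      { k = k
      ; m = m
      ; edge = merge-ends ∘ edge ∘ punchIn e
      ; edge-inj = λ {i} {j} eq → punchIn-injective e i j
          (~-edge-injective (punchInᵢ≢i e i) (punchInᵢ≢i e j) refl refl
            (merge-kernel (cong proj₁ eq)) (merge-kernel (cong proj₂ eq)))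
      ; loopless = λ j eq → ~-loopless (punchInᵢ≢i e j) refl (merge-kernel eq)
      ; pol = lastPol ∘ punchIn e
      }

    contract : ∀ {f x z} → f ≢ e → edge f ≡ (x , z) →
               ∃[ j ] (PRN.edge R′ j ≡ (merge x , merge z) × PRN.pol R′ j ≡ lastPol f)
    contract f≢e eq =
      punchOut (f≢e ∘ sym) , trans (cong (merge-ends ∘ edge) j↦f) (cong merge-ends eq) , cong lastPol j↦f
      where
      j↦f = punchIn-punchOut (f≢e ∘ sym)

    dropY : List (Fin (suc k)) → List (Fin k)
    dropY [] = []
    dropY (a ∷ as) with y ≟ a
    ... | yes _ = dropY as
    ... | no y≢a = punchOut y≢a ∷ dropY as

    dropY-y : ∀ as → dropY (y ∷ as) ≡ dropY as
    dropY-y as with y ≟ y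
    ... | yes _ = refl
    ... | no y≢y = ⊥-elim (y≢y refl)

    dropY-≢y : ∀ {a a′} as → y ≢ a → merge (inj₂ a) ≡ inj₂ a′ →
               dropY (a ∷ as) ≡ a′ ∷ dropY as
    dropY-≢y {a} as y≢a merged with y ≟ a
    ... | yes y≡a = ⊥-elim (y≢a y≡a)
    ... | no _ = cong (_∷ dropY as) (inj₂-injective merged)

    ∈-dropY : ∀ {a as} → punchIn y a ∈ as → a ∈ dropY as
    ∈-dropY {as = b ∷ _} _ with y ≟ b
    ∈-dropY (here refl) | yes y≡b = ⊥-elim (punchInᵢ≢i y _ (sym y≡b))
    ∈-dropY (here refl) | no _ = here (sym (trans (punchOut-cong y refl) (punchOut-punchIn y)))
    ∈-dropY (there a∈as) | yes _ = ∈-dropY a∈as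
    ∈-dropY (there a∈as) | no _ = there (∈-dropY a∈as)

    step-merged : ∀ {x′ a as v s} → y ≢ a → Edge R′ x′ (merge (inj₂ a)) →
                  Tail R′ (merge (inj₂ a)) (dropY as) v s → Tail R′ x′ (dropY (a ∷ as)) v s
    step-merged {a = a} y≢a E T with y ≟ a
    ... | yes y≡a = ⊥-elim (y≢a y≡a)
    ... | no _ = step E T

    -- A tail from y in the sole-out case begins with e, whose image is no edge of R′:
    -- it is pushed only together with the edge entering y.
    Pushable : V R → Set
    Pushable x = x ≡ inj₂ y → edge e ≡ (c , inj₂ y)

    pushable-≢e : ∀ {f x z} → Pushable x → edge f ≡ (x , z) → z ≢ inj₂ y → f ≢ e
    pushable-≢e ok eq z≢y refl with e-joins pendant
    ... | inj₁ e≡ = z≢y (cong proj₂ (trans (sym eq) e≡))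
    ... | inj₂ e≡ = c≢y (cong proj₁ (trans (sym (ok (cong proj₁ (trans (sym eq) e≡)))) e≡))

    mutual
      push : ∀ {x as v s} → Pushable x → Tail R x as v s → Tail R′ (merge x) (dropY as) v s
      push ok (last f eq) with contract (pushable-≢e ok eq λ ()) eq
      ... | j , eq′ , pol≡ = subst (Tail R′ _ [] _) (trans pol≡ (lastPol-≢y eq λ ())) (last j eq′)
      push ok (step (g , eq) T) = push-step ok eq T

      push-step : ∀ {g x a as v s} → Pushable x → edge g ≡ (x , inj₂ a) → Tail R (inj₂ a) as v s →
                  Tail R′ (merge x) (dropY (a ∷ as)) v s
      push-step {g} {a = a} ok eq T with a ≟ y
      ... | no a≢y = step-merged (a≢y ∘ sym)
                       (map₂ proj₁ (contract (pushable-≢e ok eq (a≢y ∘ inj₂-injective)) eq))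
                       (push (⊥-elim ∘ a≢y ∘ inj₂-injective) T)
      ... | yes refl with g ≟ e
      ...   | no g≢e with contract g≢e eq
      ...     | j , eq′ , pol≡ =
        push-out-of-y (into-y⇒e-out-of-y pendant g≢e (cong proj₂ eq))
                      (j , eq′ , trans pol≡ (lastPol-y eq)) T
      push-step ok eq T | yes refl | yes refl with e-into-y eq
      ... | refl =
        subst₂ (λ x′ as′ → Tail R′ x′ as′ _ _) merge-y (sym (dropY-y _)) (push (λ _ → eq) T)

      push-out-of-y : ∀ {x′ as v s} → edge e ≡ (inj₂ y , c) →
                      ∃[ j ] (PRN.edge R′ j ≡ (x′ , merge (inj₂ y)) × PRN.pol R′ j ≡ pol e) →
                      Tail R (inj₂ y) as v s → Tail R′ x′ (dropY (y ∷ as)) v s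
      push-out-of-y {x′} e≡ (j , eq′ , pol≡) (last f eq)
        with only-e-out-of-y pendant e≡ (cong proj₁ eq)
      ... | refl = subst₂ (λ as′ s′ → Tail R′ x′ as′ _ s′) (sym (dropY-y [])) pol≡
                     (last j (trans eq′ (cong (x′ ,_) (trans merge-y (cong merge c≡v)))))
        where
        c≡v = cong proj₂ (trans (sym e≡) eq)
      push-out-of-y {x′} e≡ (j , eq′ , _) (step {a = a} (f , eq) T)
        with only-e-out-of-y pendant e≡ (cong proj₁ eq)
      ... | refl = subst (λ as′ → Tail R′ x′ as′ _ _) (sym (dropY-y _))
                     (step-merged (a≢y ∘ cong inj₂ ∘ sym)
                       (j , trans eq′ (cong (x′ ,_) (trans merge-y (cong merge c≡a))))
                       (push (⊥-elim ∘ a≢y) T))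
        where
        c≡a = cong proj₂ (trans (sym e≡) eq)
        a≢y = c≢y ∘ trans c≡a

    Lifted : V R → List (Fin k) → Fin n → Pol → Set
    Lifted x as′ v s = ∃[ as ] (Tail R x as v s × dropY as ≡ as′)

    lift-step : ∀ {x z a′ as′ v s} → Edge R x z → z ≢ inj₂ y → merge z ≡ inj₂ a′ →
                Lifted z as′ v s → Lifted x (a′ ∷ as′) v s
    lift-step {z = inj₂ a} E a≢y merged (as , T , refl) =
      a ∷ as , step E T , dropY-≢y as (a≢y ∘ cong inj₂ ∘ sym) merged

    lift-step-y : ∀ {x as′ v s} → Edge R x (inj₂ y) → Lifted (inj₂ y) as′ v s → Lifted x as′ v s
    lift-step-y E (as , T , refl) = y ∷ as , step E T , dropY-y as

    lift-enter : ∀ {f w x as′ v s} → f ≢ e → src f ≡ w → x ≢ inj₂ y → w ~ x →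
                 Lifted w as′ v s → Lifted x as′ v s
    lift-enter _ _ _ same L = L
    lift-enter f≢e src≡y _ y~c L = lift-step-y (e , out-of-y⇒e-into-y pendant f≢e src≡y) L
    lift-enter _ _ x≢y c~y _ = ⊥-elim (x≢y refl)

    lift-last : ∀ {f x w t v} → f ≢ e → edge f ≡ (x , w) → w ~ t → t ≡ inj₁ v →
                Lifted x [] v (lastPol f)
    lift-last _ eq same refl = [] , subst (Tail R _ [] _) (sym (lastPol-≢y eq λ ())) (last _ eq) , refl
    lift-last f≢e eq y~c c≡v =
      y ∷ [] , subst (Tail R _ _ _) (sym (lastPol-y eq)) (step (_ , eq) (last e e≡)) , dropY-y []
      where
      e≡ = trans (into-y⇒e-out-of-y pendant f≢e (cong proj₂ eq)) (cong (inj₂ y ,_) c≡v)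
    lift-last _ _ c~y ()

    lift-hop : ∀ {f x w a′ as′ v s} → f ≢ e → edge f ≡ (x , w) → merge w ≡ inj₂ a′ →
               (∀ z → z ≢ inj₂ y → merge z ≡ inj₂ a′ → Lifted z as′ v s) →
               Lifted x (a′ ∷ as′) v s
    lift-hop {w = w} f≢e eq merged lift-rest with w ≟ᵛ inj₂ y
    ... | no w≢y = lift-step (_ , eq) w≢y merged (lift-rest _ w≢y merged)
    ... | yes refl = lift-step-y (_ , eq) (lift-step (e , e≡) c≢y merged-c (lift-rest _ c≢y merged-c))
      where
      e≡ = into-y⇒e-out-of-y pendant f≢e (cong proj₂ eq)
      merged-c = trans (sym merge-y) merged

    lift : ∀ {x′ as′ v s} → Tail R′ x′ as′ v s →
           ∀ x → x ≢ inj₂ y → merge x ≡ x′ → Lifted x as′ v s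
    lift (last j eq′) x x≢y refl =
      lift-enter (punchInᵢ≢i e j) refl x≢y (merge-kernel (cong proj₁ eq′))
        (lift-last (punchInᵢ≢i e j) refl (merge-kernel (cong proj₂ eq′)) refl)
    lift (step (j , eq′) T′) x x≢y refl =
      lift-enter (punchInᵢ≢i e j) refl x≢y (merge-kernel (cong proj₁ eq′))
        (lift-hop (punchInᵢ≢i e j) refl (cong proj₂ eq′) (λ z z≢y merged → lift T′ z z≢y merged))

    push-walk : ∀ {u as v s} → ValidWalk R u as v s → ValidWalk R′ u (dropY as) v s
    push-walk = push λ ()

    lift-walk : ∀ {u as′ v s} → ValidWalk R′ u as′ v s →
                ∃[ as ] (ValidWalk R u as v s × dropY as ≡ as′)
    lift-walk W = lift W _ (λ ()) refl

    strict′ : Strict R′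
    strict′ = (λ u v u≢v → unique , no-reverse u v u≢v) , on-walk′
      where
      unique : ∀ {u v} as′ bs′ s t →
               ValidWalk R′ u as′ v s → ValidWalk R′ u bs′ v t → as′ ≡ bs′
      unique _ _ _ _ W₁ W₂ with lift-walk W₁ | lift-walk W₂
      ... | _ , V₁ , refl | _ , V₂ , refl = cong dropY (validWalk-unique V₁ V₂)
      no-reverse : ∀ u v → u ≢ v → ∀ as′ bs′ s t →
                   ValidWalk R′ u as′ v s → ¬ ValidWalk R′ v bs′ u t
      no-reverse u v u≢v _ _ _ _ W₁ W₂ with lift-walk W₁ | lift-walk W₂
      ... | _ , V₁ , _ | _ , V₂ , _ = proj₂ (proj₁ strict u v u≢v) _ _ _ _ V₁ V₂
      on-walk′ : ∀ a → ∃[ u ] ∃[ v ] ∃[ as ] ∃[ s ] (ValidWalk R′ u as v s × a ∈ as)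
      on-walk′ a with proj₂ strict (punchIn y a)
      ... | u , v , as , s , W , a∈as = u , v , dropY as , s , push-walk W , ∈-dropY a∈as

    realizes′ : RealizesPolarized R′ G O
    realizes′ u v with realizes u v
    ... | to-dir , to-neg , none =
      map dropY push-walk ∘ to-dir , map dropY push-walk ∘ to-neg ,
      λ ¬dir ¬neg _ _ W → none ¬dir ¬neg _ _ (proj₁ (proj₂ (lift-walk W)))

contract-pendant : ∀ {n} (G : Diagram n) (R : PRN n) → Strict R → Realizes R G →
  (y : Fin (PRN.k R)) → ∃[ e ] ∃[ c ] Pendant R y e c →
  ∃[ R′ ] (Strict R′ × Realizes R′ G × PRN.m R′ ≤ PRN.m R ∸ 1)
contract-pendant _ record { k = zero } _ _ () _
contract-pendant _ record { m = zero } _ _ _ (() , _)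
contract-pendant G record { k = suc _ ; m = suc _ ; edge = edge ; edge-inj = edge-inj
                          ; loopless = loopless ; pol = pol }
                 strict (O , realizes) y (e , c , pendant) = R′ , strict′ , (O , realizes′) , ≤-refl
  where open Network.Contraction edge edge-inj loopless pol {G = G} {O = O} realizes strict pendant

lemma29 : ∀ {n : ℕ} (G : Diagram n) (R : PRN n) →
    Strict R → Realizes R G →
    (y : Fin (PRN.k R)) →
    (InDeg R (inj₂ y) ≡ 1 ⊎ OutDeg R (inj₂ y) ≡ 1) →
    ∃[ R′ ] (Strict R′ × Realizes R′ G × PRN.m R′ ≤ PRN.m R ∸ 1)
lemma29 G R strict realizes y degree =
  contract-pendant G R strict realizes y (pendant-of-degree R y degree)
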